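{- Let $A = 00$, $B = 11$, $C = 010010$, $D = 101101$, and $\mathcal{A} = \{A, B, C, D\}$. Then every concatenation of nine or more words chosen from $\mathcal{A}$ (with repetition allowed) contains an overlap. Furthermore, if $w$ is an overlap-free concatenation of $8$ words from $\mathcal{A}$, then for each letter $c \in \{0,1\}$, both $cw$ and $wc$ contain an overlap.
   Context: An overlap is a word of the form $axaxa$ where $a$ is a single letter and $x$ is a possibly empty word. A word is overlap-free if none of its factors (contiguous subwords) is an overlap. -}

module Defs where

open import Data.List using (List; []; _∷_; _++_; [_]; concat; map; length)
open import Data.Product using (∃; ∃-syntax; _×_; _,_)
open import Relation.Binary.PropositionalEquality using (_≡_)
open import Relation.Nullary using (¬_)

data Bit : Set where
  b0 b1 : Bit

Word : Set
Word = List Bit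

IsOverlap : Word → Set
IsOverlap w = ∃[ a ] ∃[ x ] (w ≡ a ∷ (x ++ (a ∷ (x ++ [ a ]))))

IsFactor : Word → Word → Set
IsFactor f w = ∃[ u ] ∃[ v ] (w ≡ u ++ (f ++ v))

ContainsOverlap : Word → Set
ContainsOverlap w = ∃[ f ] (IsFactor f w × IsOverlap f)

OverlapFree : Word → Set
OverlapFree w = ¬ ContainsOverlap w

data Block : Set where
  A B C D : Block

block : Block → Word
block A = b0 ∷ b0 ∷ []
block B = b1 ∷ b1 ∷ []
block C = b0 ∷ b1 ∷ b0 ∷ b0 ∷ b1 ∷ b0 ∷ []
block D = b1 ∷ b0 ∷ b1 ∷ b1 ∷ b0 ∷ b1 ∷ []

concatBlocks : List Block → Word
concatBlocks bs = concat (map block bs)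

-- An overlap-free concatenation of blocks can be grown one block at a time, and
-- an overlap in a prefix persists in every extension. So both claims follow by
-- exploring the tree of block sequences, pruning each node whose concatenation
-- already contains an overlap: no sequence of nine blocks survives, and each
-- surviving sequence of eight blocks is checked against the four one-letter
-- extensions.
module Submission where

open import Defs
open import Data.Nat using (ℕ; zero; suc; _≤_)
open import Data.Nat.Properties using (m≤n⇒m⊓n≡m)
open import Data.List using (List; []; _∷_; _++_; [_]; _∷ʳ_; length; foldr; inits; take; drop)
open import Data.List.Properties using (++-assoc; ++-identityʳ; ∷ʳ-++; concatMap-++; length-take; take++drop≡id)
open import Data.Maybe as Maybe using (Maybe; just; nothing; _<∣>_; from-just)
open import Data.Product using (_×_; _,_; ∃-syntax)
open import Data.Empty using (⊥-elim)
open import Relation.Binary.PropositionalEquality using (_≡_; refl; sym; trans; cong; subst; module ≡-Reasoning)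

overlapOf : Bit → Word → Word
overlapOf a x = a ∷ x ++ a ∷ x ++ [ a ]

bitEq : (x y : Bit) → Maybe (x ≡ y)
bitEq b0 b0 = just refl
bitEq b1 b1 = just refl
bitEq _  _  = nothing

stripPrefix : (p s : Word) → Maybe (∃[ v ] s ≡ p ++ v)
stripPrefix []      s       = just (s , refl)
stripPrefix (_ ∷ _) []      = nothing
stripPrefix (x ∷ p) (y ∷ s) with bitEq x y | stripPrefix p s
... | just refl | just (v , s≡p++v) = just (v , cong (x ∷_) s≡p++v)
... | _         | _                 = nothing

firstJust : {A B : Set} → (A → Maybe B) → List A → Maybe B
firstJust f = foldr (λ x rest → f x <∣> rest) nothing

PrefixOverlap : Word → Set
PrefixOverlap s = ∃[ f ] ∃[ v ] (s ≡ f ++ v × IsOverlap f)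

-- An overlap that is a prefix of a ∷ t is overlapOf a x for some x in inits t.
findPrefixOverlap : (s : Word) → Maybe (PrefixOverlap s)
findPrefixOverlap []      = nothing
findPrefixOverlap (a ∷ t) = firstJust try (inits t)
  where
  try : Word → Maybe (PrefixOverlap (a ∷ t))
  try x = Maybe.map (λ (v , e) → overlapOf a x , v , e , a , x , refl)
                    (stripPrefix (overlapOf a x) (a ∷ t))

containsOverlap-∷ : (a : Bit) (w : Word) → ContainsOverlap w → ContainsOverlap (a ∷ w)
containsOverlap-∷ a w (f , (u , v , w≡) , o) = f , (a ∷ u , v , cong (a ∷_) w≡) , o

containsOverlap-++ʳ : (w v : Word) → ContainsOverlap w → ContainsOverlap (w ++ v)
containsOverlap-++ʳ w v (f , (u , v′ , w≡) , o) =
  f , (u , v′ ++ v , w++v≡) , o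
  where
  open ≡-Reasoning
  w++v≡ : w ++ v ≡ u ++ f ++ v′ ++ v
  w++v≡ = begin
    w ++ v               ≡⟨ cong (_++ v) w≡ ⟩
    (u ++ f ++ v′) ++ v  ≡⟨ ++-assoc u (f ++ v′) v ⟩
    u ++ (f ++ v′) ++ v  ≡⟨ cong (u ++_) (++-assoc f v′ v) ⟩
    u ++ f ++ v′ ++ v    ∎

findOverlap : (w : Word) → Maybe (ContainsOverlap w)
findOverlap []      = nothing
findOverlap (a ∷ t) =
  Maybe.map (λ (f , v , e , o) → f , ([] , v , e) , o) (findPrefixOverlap (a ∷ t))
  <∣> Maybe.map (containsOverlap-∷ a t) (findOverlap t)

concatBlocks-++ : (bs rs : List Block) → concatBlocks (bs ++ rs) ≡ concatBlocks bs ++ concatBlocks rs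
concatBlocks-++ = concatMap-++ block

containsOverlap-extend : (bs rs : List Block) →
                         ContainsOverlap (concatBlocks bs) → ContainsOverlap (concatBlocks (bs ++ rs))
containsOverlap-extend bs rs o = subst ContainsOverlap (sym (concatBlocks-++ bs rs)) (containsOverlap-++ʳ _ _ o)

forAllBlocks : {P : Block → Set} → ((b : Block) → Maybe (P b)) → Maybe ((b : Block) → P b)
forAllBlocks f with f A | f B | f C | f D
... | just pA | just pB | just pC | just pD = just λ { A → pA ; B → pB ; C → pC ; D → pD }
... | _       | _       | _       | _       = nothing

AllExtensions : (List Block → Set) → ℕ → List Block → Set
AllExtensions Q n bs = (rs : List Block) → length rs ≡ n → Q (bs ++ rs)

module _ {Q : List Block → Set} where

  allExtensions-zero : {bs : List Block} → Q bs → AllExtensions Q 0 bs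
  allExtensions-zero {bs} q [] _ = subst Q (sym (++-identityʳ bs)) q

  allExtensions-suc : {n : ℕ} {bs : List Block} →
                      ((b : Block) → AllExtensions Q n (bs ∷ʳ b)) → AllExtensions Q (suc n) bs
  allExtensions-suc {bs = bs} q (b ∷ rs) refl = subst Q (∷ʳ-++ bs b rs) (q b rs refl)

  searchExtensions : (prune : (bs : List Block) → Maybe ((rs : List Block) → Q (bs ++ rs)))
                     (leaf : (bs : List Block) → Maybe (Q bs))
                     (n : ℕ) (bs : List Block) → Maybe (AllExtensions Q n bs)
  searchExtensions prune leaf n bs with prune bs
  ... | just q = just λ rs _ → q rs
  searchExtensions prune leaf zero    bs | nothing = Maybe.map allExtensions-zero (leaf bs)
  searchExtensions prune leaf (suc n) bs | nothing =
    Maybe.map allExtensions-suc (forAllBlocks λ b → searchExtensions prune leaf n (bs ∷ʳ b))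

Inextensible : Word → Set
Inextensible w = (c : Bit) → ContainsOverlap (c ∷ w) × ContainsOverlap (w ++ [ c ])

findInextensible : (w : Word) → Maybe (Inextensible w)
findInextensible w
  with findOverlap (b0 ∷ w) | findOverlap (w ++ [ b0 ]) | findOverlap (b1 ∷ w) | findOverlap (w ++ [ b1 ])
... | just l0 | just r0 | just l1 | just r1 = just λ { b0 → l0 , r0 ; b1 → l1 , r1 }
... | _       | _       | _       | _       = nothing

nineBlocks-overlap : (bs : List Block) → length bs ≡ 9 → ContainsOverlap (concatBlocks bs)
nineBlocks-overlap = from-just (searchExtensions {Q} prune (λ _ → nothing) 9 [])
  where
  Q : List Block → Set
  Q bs = ContainsOverlap (concatBlocks bs)

  prune : (bs : List Block) → Maybe ((rs : List Block) → Q (bs ++ rs))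
  prune bs = Maybe.map (λ o rs → containsOverlap-extend bs rs o) (findOverlap (concatBlocks bs))

eightBlocks-inextensible : (bs : List Block) → length bs ≡ 8 →
                           OverlapFree (concatBlocks bs) → Inextensible (concatBlocks bs)
eightBlocks-inextensible = from-just (searchExtensions {Q} prune leaf 8 [])
  where
  Q : List Block → Set
  Q bs = OverlapFree (concatBlocks bs) → Inextensible (concatBlocks bs)

  prune : (bs : List Block) → Maybe ((rs : List Block) → Q (bs ++ rs))
  prune bs = Maybe.map (λ o rs free → ⊥-elim (free (containsOverlap-extend bs rs o))) (findOverlap (concatBlocks bs))

  leaf : (bs : List Block) → Maybe (Q bs)
  leaf bs = Maybe.map (λ i _ → i) (findInextensible (concatBlocks bs))

atLeastNineBlocks-overlap : (bs : List Block) → 9 ≤ length bs → ContainsOverlap (concatBlocks bs)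
atLeastNineBlocks-overlap bs 9≤ =
  subst (λ cs → ContainsOverlap (concatBlocks cs)) (take++drop≡id 9 bs)
    (containsOverlap-extend (take 9 bs) (drop 9 bs)
      (nineBlocks-overlap (take 9 bs) (trans (length-take 9 bs) (m≤n⇒m⊓n≡m 9≤))))

lemma7 : ((bs : List Block) → 9 ≤ length bs → ContainsOverlap (concatBlocks bs))
    × ((bs : List Block) → length bs ≡ 8 → OverlapFree (concatBlocks bs)
        → (c : Bit) → ContainsOverlap (c ∷ concatBlocks bs)
          × ContainsOverlap (concatBlocks bs ++ [ c ]))
lemma7 = atLeastNineBlocks-overlap , eightBlocks-inextensible
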